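{- Let $A=\{a_1<a_2<\dots<a_k\}$ and $B$ be finite sets of integers, and let $\mathrm{maxcol}(A,B)=\{c_1<\dots<c_k\}$. (1) For all $i=1,\dots,k$, $[c_i,a_i]\cap\mathbb Z\subseteq B\cup\{c_i,c_{i+1},\dots,c_k\}$. (2) $A\setminus B\subseteq\mathrm{maxcol}(A,B)$, and $\mathrm{maxcol}(A,B)=(A\setminus B)\sqcup\mathrm{maxcol}(A\cap B,A\cup B)$ (disjoint union).
   Context: For finite sets of integers $A=\{a_1<\dots<a_k\}$ and $B$, $\mathrm{maxcol}(A,B)$ is the $k$-element set $\{c_1<\dots<c_k\}$ defined recursively by $c_k=\max\,(\{c\in\mathbb Z:c\le a_k\}\setminus B)$ and $c_i=\max\,(\{c\in\mathbb Z:c\le a_i,\ c<c_{i+1}\}\setminus B)$ for $i=k-1,\dots,1$; equivalently, the maximum, under entrywise comparison of increasingly sorted sequences, of the $k$-element sets $C\subset\mathbb Z$ with $C\le A$ entrywise and $C\cap B=\emptyset$. -}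

module Defs where

open import Data.Nat using (ℕ; zero; suc)
open import Data.Integer using (ℤ; _-_; 1ℤ; _⊓_)
open import Data.Integer.Properties using (_≟_)
open import Data.List using (List; []; _∷_; length; reverse; lookup; filter; _++_)
open import Data.List.Properties using (length-reverse)
open import Data.List.Membership.DecPropositional _≟_ using (_∈?_)
open import Data.Maybe using (Maybe; just; nothing)
open import Data.Fin using (Fin; cast)
open import Relation.Nullary using (yes; no)
open import Relation.Binary.PropositionalEquality using (_≡_; refl; cong; trans; sym)

-- maxBelow x B = max ({c ∈ ℤ : c ≤ x} \ B).
-- Implemented by scanning downward from x; the fuel length B suffices, since
-- if x, x-1, ..., x-(length B)+1 all lie in B then these are all of B's
-- elements and x - length B ∉ B.
maxBelowFuel : ℕ → ℤ → List ℤ → ℤ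
maxBelowFuel zero x B = x
maxBelowFuel (suc n) x B with x ∈? B
... | yes _ = maxBelowFuel n (x - 1ℤ) B
... | no _ = x

maxBelow : ℤ → List ℤ → ℤ
maxBelow x B = maxBelowFuel (length B) x B

-- Process A from its largest element downward: the argument list is
-- a_k, a_{k-1}, ..., a_1 and the output is c_k, c_{k-1}, ..., c_1, where
-- c_k = maxBelow a_k B and c_i = maxBelow (min a_i (c_{i+1} - 1)) B
-- (i.e. max {c ≤ a_i, c < c_{i+1}} \ B).
maxcolDesc : List ℤ → Maybe ℤ → List ℤ → List ℤ
maxcolDesc B _ [] = []
maxcolDesc B nothing (a ∷ as) = maxBelow a B ∷ maxcolDesc B (just (maxBelow a B)) as
maxcolDesc B (just p) (a ∷ as) =
  maxBelow (a ⊓ (p - 1ℤ)) B ∷ maxcolDesc B (just (maxBelow (a ⊓ (p - 1ℤ)) B)) as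

-- maxcol A B for A given as a strictly increasing list a_1 < ... < a_k;
-- the result is the list c_1 < ... < c_k.
maxcol : List ℤ → List ℤ → List ℤ
maxcol A B = reverse (maxcolDesc B nothing (reverse A))

maxcolDesc-length : ∀ B m (as : List ℤ) → length (maxcolDesc B m as) ≡ length as
maxcolDesc-length B _ [] = refl
maxcolDesc-length B nothing (a ∷ as) = cong suc (maxcolDesc-length B _ as)
maxcolDesc-length B (just p) (a ∷ as) = cong suc (maxcolDesc-length B _ as)

maxcol-length : ∀ A B → length (maxcol A B) ≡ length A
maxcol-length A B =
  trans (length-reverse (maxcolDesc B nothing (reverse A)))
        (trans (maxcolDesc-length B nothing (reverse A)) (length-reverse A))

-- c_i, for i = 1..k indexed by Fin k (0-based).
col : (A B : List ℤ) → Fin (length A) → ℤ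
col A B i = lookup (maxcol A B) (cast (sym (maxcol-length A B)) i)

-- A ∩ B, as a sublist of A (so it stays strictly increasing), and A ∪ B.
_∩ˡ_ : List ℤ → List ℤ → List ℤ
A ∩ˡ B = filter (_∈? B) A

_∪ˡ_ : List ℤ → List ℤ → List ℤ
A ∪ˡ B = A ++ B

-- maxcol is the greedy assignment in which a_k, …, a_1 in turn take the
-- largest integer below them that is neither in B nor already taken: the
-- constraint c_i < c_{i+1} is automatic, because every integer of
-- [c_{i+1}, a_{i+1}] is blocked and a_i < a_{i+1}.  Greedy assignment does not
-- depend on the order in which the targets are processed: two targets either
-- pick different integers, which they still do in the other order, or share
-- their first choice, after which they compete for the same next one.
-- Processing A ∖ B first, each of its elements takes itself; the rest of A,
-- namely A ∩ B, then faces the blocked set (A ∖ B) ∪ B, which has the same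
-- elements as A ∪ B.  This gives (2); (1) is the maximality of each greedy
-- choice.
module Submission where

open import Defs
open import Data.Empty using (⊥-elim)
open import Data.Fin as Fin using (Fin; toℕ; cast) renaming (_≤_ to _≤ᶠ_)
open import Data.Fin.Properties using (toℕ-cast; cast-involutive)
open import Data.Integer using (ℤ; _≤_; _<_; _>_; _≤?_; _-_; 1ℤ; -1ℤ; _⊓_; pred)
open import Data.Integer.Properties
  using (_≟_; ≤-refl; ≤-trans; <-trans; <⇒≤; <-irrefl; <-cmp; <-≤-trans; ≤-<-trans;
         ≤∧≢⇒<; <⇒≢; ≮⇒≥; +-comm; i⊓j≤i; i⊓j≤j; ⊓-glb; i≤pred[j]⇒i<j; i<j⇒i≤pred[j])
open import Data.List using (List; []; _∷_; [_]; length; lookup; filter; reverse; _++_)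
open import Data.List.Properties
  using (length-reverse; reverse-++; unfold-reverse; ++-assoc; filter-notAll; partition-defn)
open import Data.List.Membership.DecPropositional _≟_ using (_∈?_)
open import Data.List.Membership.Propositional using (_∈_; _∉_)
open import Data.List.Membership.Propositional.Properties using (∈-filter⁺; ∈-filter⁻; ∈-++⁺ˡ; ∈-++⁺ʳ; ∈-++⁻)
open import Data.List.Relation.Unary.Any using (here; there)
import Data.List.Relation.Unary.Any as Any
open import Data.List.Relation.Unary.Any.Properties using (reverse⁺)
open import Data.List.Relation.Unary.All using (All; []; _∷_)
import Data.List.Relation.Unary.All as All
open import Data.List.Relation.Unary.AllPairs using (AllPairs; []; _∷_)
import Data.List.Relation.Unary.AllPairs as AllPairs
import Data.List.Relation.Unary.AllPairs.Properties as AllPairsP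
open import Data.List.Relation.Unary.Linked using (Linked; _∷_)
open import Data.List.Relation.Unary.Linked.Properties using (Linked⇒AllPairs; AllPairs⇒Linked)
import Data.List.Relation.Unary.Linked.Properties as LinkedP
open import Data.List.Relation.Unary.Unique.Propositional using (Unique)
import Data.List.Relation.Unary.Unique.Propositional.Properties as UniqueP
open import Data.List.Relation.Binary.Subset.Propositional using (_⊆_)
open import Data.List.Relation.Binary.Subset.Propositional.Properties
  using (⊆-reflexive-↭; filter-⊆) renaming (++⁺ to ++⁺-⊆)
open import Data.List.Relation.Binary.Permutation.Propositional
  using (_↭_; refl; prep; swap; ↭-trans; ↭-sym; ↭-reflexive; ↭ₛ⇒↭; module PermutationReasoning)
open import Data.List.Relation.Binary.Permutation.Propositional.Properties
  using (∈-resp-↭; ↭-reverse; shift; ++⁺ˡ; ++-comm)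
import Data.List.Relation.Binary.Permutation.Setoid.Properties as PermutationSetoid
open import Data.Maybe using (just; nothing)
open import Data.Nat as ℕ using (zero; suc; z≤n; s≤s)
import Data.Nat.Properties as ℕ
open import Data.Product using (_×_; _,_; proj₁; proj₂; ∃; ∃₂)
open import Data.Sum using (_⊎_; inj₁; inj₂)
open import Function using (_∘_; flip)
open import Function.Bundles using (_⇔_; mk⇔; Equivalence)
open import Relation.Binary using (tri<; tri≈; tri>)
open import Relation.Binary.PropositionalEquality
  using (_≡_; _≢_; refl; sym; trans; cong; subst; setoid; module ≡-Reasoning)
open import Relation.Nullary using (¬_; yes; no; ¬?)
open import Relation.Unary.Properties using (∁?)

i-1≡pred[i] : ∀ i → i - 1ℤ ≡ pred i
i-1≡pred[i] i = +-comm i -1ℤ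

i-1<i : ∀ i → i - 1ℤ < i
i-1<i i rewrite i-1≡pred[i] i = i≤pred[j]⇒i<j ≤-refl

i<j⇒i≤j-1 : ∀ {i j} → i < j → i ≤ j - 1ℤ
i<j⇒i≤j-1 {j = j} i<j rewrite i-1≡pred[i] j = i<j⇒i≤pred[j] i<j

i≰j-1⇒j≤i : ∀ {i j} → ¬ (i ≤ j - 1ℤ) → j ≤ i
i≰j-1⇒j≤i i≰j-1 = ≮⇒≥ (i≰j-1 ∘ i<j⇒i≤j-1)

module _ {ℓ} {X : Set ℓ} where

  lookup-split : ∀ (xs : List X) i → ∃₂ λ pre post → xs ≡ pre ++ lookup xs i ∷ post × length pre ≡ toℕ i
  lookup-split (x ∷ xs) Fin.zero = [] , xs , refl , refl
  lookup-split (x ∷ xs) (Fin.suc i) with lookup-split xs i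
  ... | pre , post , xs≡ , length-pre = x ∷ pre , post , cong (x ∷_) xs≡ , cong suc length-pre

  lookup-at-length : ∀ {xs} P (q : X) Q → xs ≡ P ++ q ∷ Q → ∀ k → toℕ k ≡ length P → lookup xs k ≡ q
  lookup-at-length [] q Q refl Fin.zero _ = refl
  lookup-at-length (_ ∷ P) q Q refl (Fin.suc k) k≡ = lookup-at-length P q Q refl k (ℕ.suc-injective k≡)

  ∈-suffix⇒lookup : ∀ {xs} P Q {y : X} → xs ≡ P ++ Q → y ∈ Q → ∃ λ k → length P ℕ.≤ toℕ k × lookup xs k ≡ y
  ∈-suffix⇒lookup [] (q ∷ Q) refl (here y≡q) = Fin.zero , z≤n , sym y≡q
  ∈-suffix⇒lookup [] (q ∷ Q) refl (there y∈Q) with ∈-suffix⇒lookup [] Q refl y∈Q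
  ... | k , _ , lookup≡ = Fin.suc k , z≤n , lookup≡
  ∈-suffix⇒lookup (_ ∷ P) Q refl y∈Q with ∈-suffix⇒lookup P Q refl y∈Q
  ... | k , P≤k , lookup≡ = Fin.suc k , s≤s P≤k , lookup≡

  reverse-++-∷ : ∀ P (q : X) Q → reverse (P ++ q ∷ Q) ≡ reverse Q ++ q ∷ reverse P
  reverse-++-∷ P q Q = begin
    reverse (P ++ q ∷ Q)          ≡⟨ reverse-++ P (q ∷ Q) ⟩
    reverse (q ∷ Q) ++ reverse P  ≡⟨ cong (_++ reverse P) (unfold-reverse q Q) ⟩
    (reverse Q ++ [ q ]) ++ reverse P ≡⟨ ++-assoc (reverse Q) [ q ] (reverse P) ⟩
    reverse Q ++ q ∷ reverse P    ∎
    where open ≡-Reasoning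

  AllPairs-reverse : ∀ {r} {R : X → X → Set r} {xs} → AllPairs R xs → AllPairs (flip R) (reverse xs)
  AllPairs-reverse {xs = []} [] = []
  AllPairs-reverse {xs = x ∷ xs} (x≺xs ∷ pairs) rewrite unfold-reverse x xs =
    AllPairsP.++⁺ (AllPairs-reverse pairs) ([] ∷ [])
      (All.tabulate (λ y∈rev → All.lookup x≺xs (∈-resp-↭ (↭-reverse xs) y∈rev) ∷ []))

record IsMaxBelow (x : ℤ) (S : List ℤ) (m : ℤ) : Set where
  field
    ≤bound : m ≤ x
    ∉set   : m ∉ S
    gap⊆   : ∀ {y} → m < y → y ≤ x → y ∈ S
open IsMaxBelow

IsMaxBelow-unique : ∀ {x S m m′} → IsMaxBelow x S m → IsMaxBelow x S m′ → m ≡ m′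
IsMaxBelow-unique {m = m} {m′} p q with <-cmp m m′
... | tri< m<m′ _ _ = ⊥-elim (∉set q (gap⊆ p m<m′ (≤bound q)))
... | tri≈ _ m≡m′ _ = m≡m′
... | tri> _ _ m′<m = ⊥-elim (∉set p (gap⊆ q m′<m (≤bound p)))

IsMaxBelow-resp-⊆ : ∀ {x S S′ m} → S ⊆ S′ → S′ ⊆ S → IsMaxBelow x S m → IsMaxBelow x S′ m
IsMaxBelow-resp-⊆ S⊆S′ S′⊆S p = record
  { ≤bound = ≤bound p ; ∉set = ∉set p ∘ S′⊆S ; gap⊆ = λ m<y y≤x → S⊆S′ (gap⊆ p m<y y≤x) }

IsMaxBelow-self : ∀ {x S} → x ∉ S → IsMaxBelow x S x
IsMaxBelow-self x∉S = record
  { ≤bound = ≤-refl ; ∉set = x∉S ; gap⊆ = λ x<y y≤x → ⊥-elim (<-irrefl refl (<-≤-trans x<y y≤x)) }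

IsMaxBelow-∷ : ∀ {x S m c} → m ≢ c → IsMaxBelow x S m → IsMaxBelow x (c ∷ S) m
IsMaxBelow-∷ m≢c p = record
  { ≤bound = ≤bound p
  ; ∉set   = λ { (here m≡c) → m≢c m≡c ; (there m∈S) → ∉set p m∈S }
  ; gap⊆   = λ m<y y≤x → there (gap⊆ p m<y y≤x)
  }

IsMaxBelow-share : ∀ {a b S c m} → IsMaxBelow a S c → IsMaxBelow b S c →
                   IsMaxBelow b (c ∷ S) m → IsMaxBelow a (c ∷ S) m
IsMaxBelow-share {a} {b} {S} {c} {m} pa pb pm = record
  { ≤bound = ≤-trans (<⇒≤ m<c) (≤bound pa) ; ∉set = ∉set pm ; gap⊆ = gap }
  where
  m<c : m < c
  m<c with <-cmp m c
  ... | tri< m<c _ _ = m<c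
  ... | tri≈ _ m≡c _ = ⊥-elim (∉set pm (here m≡c))
  ... | tri> _ _ c<m = ⊥-elim (∉set pm (there (gap⊆ pb c<m (≤bound pm))))
  gap : ∀ {y} → m < y → y ≤ a → y ∈ c ∷ S
  gap {y} m<y y≤a with <-cmp y c
  ... | tri< y<c _ _ = gap⊆ pm m<y (≤-trans (<⇒≤ y<c) (≤bound pb))
  ... | tri≈ _ y≡c _ = here y≡c
  ... | tri> _ _ c<y = there (gap⊆ pa c<y y≤a)

maxBelowFuel-≤ : ∀ n x S → maxBelowFuel n x S ≤ x
maxBelowFuel-≤ zero x S = ≤-refl
maxBelowFuel-≤ (suc n) x S with x ∈? S
... | yes _ = ≤-trans (maxBelowFuel-≤ n (x - 1ℤ) S) (<⇒≤ (i-1<i x))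
... | no _ = ≤-refl

maxBelowFuel-gap⊆ : ∀ n x S {y} → maxBelowFuel n x S < y → y ≤ x → y ∈ S
maxBelowFuel-gap⊆ zero x S m<y y≤x = ⊥-elim (<-irrefl refl (<-≤-trans m<y y≤x))
maxBelowFuel-gap⊆ (suc n) x S {y} m<y y≤x with x ∈? S
... | no _ = ⊥-elim (<-irrefl refl (<-≤-trans m<y y≤x))
... | yes x∈S with y ≟ x
...   | yes refl = x∈S
...   | no y≢x = maxBelowFuel-gap⊆ n (x - 1ℤ) S m<y (i<j⇒i≤j-1 (≤∧≢⇒< y≤x y≢x))

maxBelowFuel-cong : ∀ n x {S S′} →
                    (∀ {z} → z ≤ x → z ∈ S → z ∈ S′) → (∀ {z} → z ≤ x → z ∈ S′ → z ∈ S) →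
                    maxBelowFuel n x S ≡ maxBelowFuel n x S′
maxBelowFuel-cong zero x _ _ = refl
maxBelowFuel-cong (suc n) x {S} {S′} S→S′ S′→S with x ∈? S | x ∈? S′
... | yes _ | yes _ = maxBelowFuel-cong n (x - 1ℤ) (S→S′ ∘ below) (S′→S ∘ below)
  where
  below : ∀ {z} → z ≤ x - 1ℤ → z ≤ x
  below z≤x-1 = ≤-trans z≤x-1 (<⇒≤ (i-1<i x))
... | yes x∈S | no x∉S′ = ⊥-elim (x∉S′ (S→S′ ≤-refl x∈S))
... | no x∉S | yes x∈S′ = ⊥-elim (x∉S (S′→S ≤-refl x∈S′))
... | no _ | no _ = refl

maxBelowFuel-∈⇒fuel<length : ∀ n x S → maxBelowFuel n x S ∈ S → n ℕ.< length S
maxBelowFuel-∈⇒fuel<length zero x (_ ∷ _) _ = s≤s z≤n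
maxBelowFuel-∈⇒fuel<length (suc n) x S m∈S with x ∈? S
... | no x∉S = ⊥-elim (x∉S m∈S)
... | yes x∈S = ℕ.≤-<-trans (maxBelowFuel-∈⇒fuel<length n (x - 1ℤ) S₋ m∈S₋) S₋-shorter
  where
  ≢x? = λ z → ¬? (z ≟ x)
  S₋ = filter ≢x? S
  <x : ∀ {z} → z ≤ x - 1ℤ → z ≢ x
  <x z≤x-1 = <⇒≢ (≤-<-trans z≤x-1 (i-1<i x))
  same-scan : maxBelowFuel n (x - 1ℤ) S ≡ maxBelowFuel n (x - 1ℤ) S₋
  same-scan = maxBelowFuel-cong n (x - 1ℤ) (λ z≤ z∈S → ∈-filter⁺ ≢x? z∈S (<x z≤)) (λ _ → proj₁ ∘ ∈-filter⁻ ≢x?)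
  m∈S₋ : maxBelowFuel n (x - 1ℤ) S₋ ∈ S₋
  m∈S₋ = ∈-filter⁺ ≢x? (subst (_∈ S) same-scan m∈S) (<x (maxBelowFuel-≤ n (x - 1ℤ) S₋))
  S₋-shorter : length S₋ ℕ.< length S
  S₋-shorter = filter-notAll ≢x? S (Any.map (λ z≡x z≢x → z≢x (sym z≡x)) x∈S)

maxBelow-isMaxBelow : ∀ x S → IsMaxBelow x S (maxBelow x S)
maxBelow-isMaxBelow x S = record
  { ≤bound = maxBelowFuel-≤ (length S) x S
  ; ∉set   = λ m∈S → ℕ.<-irrefl refl (maxBelowFuel-∈⇒fuel<length (length S) x S m∈S)
  ; gap⊆   = maxBelowFuel-gap⊆ (length S) x S
  }

maxBelow-unique : ∀ {x S m} → IsMaxBelow x S m → maxBelow x S ≡ m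
maxBelow-unique {x} {S} = IsMaxBelow-unique (maxBelow-isMaxBelow x S)

maxBelow-cong : ∀ x {S S′} → S ⊆ S′ → S′ ⊆ S → maxBelow x S ≡ maxBelow x S′
maxBelow-cong x {S} S⊆S′ S′⊆S =
  sym (maxBelow-unique (IsMaxBelow-resp-⊆ S⊆S′ S′⊆S (maxBelow-isMaxBelow x S)))

greedy : List ℤ → List ℤ → List ℤ
greedy S [] = []
greedy S (a ∷ L) = maxBelow a S ∷ greedy (maxBelow a S ∷ S) L

length-greedy : ∀ S L → length (greedy S L) ≡ length L
length-greedy S [] = refl
length-greedy S (a ∷ L) = cong suc (length-greedy _ L)

greedy-cong : ∀ L {S S′} → S ⊆ S′ → S′ ⊆ S → greedy S L ≡ greedy S′ L
greedy-cong [] _ _ = refl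
greedy-cong (a ∷ L) S⊆S′ S′⊆S rewrite maxBelow-cong a S⊆S′ S′⊆S =
  cong (_ ∷_) (greedy-cong L (∷⊆∷ S⊆S′) (∷⊆∷ S′⊆S))
  where
  ∷⊆∷ : ∀ {c T T′} → T ⊆ T′ → c ∷ T ⊆ c ∷ T′
  ∷⊆∷ T⊆T′ (here y≡c) = here y≡c
  ∷⊆∷ T⊆T′ (there y∈T) = there (T⊆T′ y∈T)

∈-greedy⇒∉ : ∀ L S {y} → y ∈ greedy S L → y ∉ S
∈-greedy⇒∉ (a ∷ L) S (here refl) = ∉set (maxBelow-isMaxBelow a S)
∈-greedy⇒∉ (a ∷ L) S (there y∈G) y∈S = ∈-greedy⇒∉ L _ y∈G (there y∈S)

greedy-++ : ∀ S L L′ → greedy S (L ++ L′) ≡ greedy S L ++ greedy (greedy S L ++ S) L′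
greedy-++ S [] L′ = refl
greedy-++ S (a ∷ L) L′ = cong (c ∷_) (trans (greedy-++ (c ∷ S) L L′) (cong (greedy (c ∷ S) L ++_)
  (greedy-cong L′ (⊆-reflexive-↭ (shift c G S)) (⊆-reflexive-↭ (↭-sym (shift c G S))))))
  where
  c = maxBelow a S
  G = greedy (c ∷ S) L

greedy-fresh : ∀ S U → All (_∉ S) U → Unique U → greedy S U ≡ U
greedy-fresh S [] _ _ = refl
greedy-fresh S (u ∷ U) (u∉S ∷ U∉S) (u∉U ∷ uniqueU) rewrite maxBelow-unique (IsMaxBelow-self u∉S) =
  cong (u ∷_) (greedy-fresh (u ∷ S) U (All.zipWith ∉u∷S (u∉U , U∉S)) uniqueU)
  where
  ∉u∷S : ∀ {v} → u ≢ v × v ∉ S → v ∉ u ∷ S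
  ∉u∷S (u≢v , _) (here v≡u) = u≢v (sym v≡u)
  ∉u∷S (_ , v∉S) (there v∈S) = v∉S v∈S

greedy-↭ : ∀ {L L′} → L ↭ L′ → ∀ S → greedy S L ↭ greedy S L′
greedy-↭ refl S = refl
greedy-↭ (prep a p) S = prep _ (greedy-↭ p _)
greedy-↭ (_↭_.trans p q) S = ↭-trans (greedy-↭ p S) (greedy-↭ q S)
greedy-↭ {a ∷ b ∷ L} {_ ∷ _ ∷ L′} (swap _ _ p) S with maxBelow a S ≟ maxBelow b S
... | no ca≢cb
  rewrite maxBelow-unique (IsMaxBelow-∷ (ca≢cb ∘ sym) (maxBelow-isMaxBelow b S))
        | maxBelow-unique (IsMaxBelow-∷ ca≢cb (maxBelow-isMaxBelow a S))
  = swap _ _ (↭-trans (greedy-↭ p _) (↭-reflexive (greedy-cong L′ (⊆-reflexive-↭ (swap _ _ refl))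
                                                                (⊆-reflexive-↭ (swap _ _ refl)))))
... | yes ca≡cb = shared
  where
  c = maxBelow a S
  m = maxBelow b (c ∷ S)
  a-next : maxBelow a (c ∷ S) ≡ m
  a-next = maxBelow-unique (IsMaxBelow-share (maxBelow-isMaxBelow a S)
                             (subst (IsMaxBelow b S) (sym ca≡cb) (maxBelow-isMaxBelow b S))
                             (maxBelow-isMaxBelow b (c ∷ S)))
  shared : c ∷ m ∷ greedy (m ∷ c ∷ S) L ↭
           maxBelow b S ∷ maxBelow a (maxBelow b S ∷ S) ∷ greedy (maxBelow a (maxBelow b S ∷ S) ∷ maxBelow b S ∷ S) L′
  shared rewrite sym ca≡cb | a-next = prep c (prep m (greedy-↭ p _))

-- The invariant relating the state of maxcolDesc (previous column p and
-- previous target top) to the set S blocked so far by greedy.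
record Frontier (B S : List ℤ) (p top : ℤ) : Set where
  field
    B⊆S       : B ⊆ S
    ≥p-off-B  : ∀ {y} → y ∈ S → y ∉ B → p ≤ y
    [p,top]⊆S : ∀ {y} → p ≤ y → y ≤ top → y ∈ S
open Frontier

Frontier-take : ∀ {B S a m} → B ⊆ S → (∀ {y} → y ∈ S → y ∉ B → m ≤ y) →
                IsMaxBelow a S m → Frontier B (m ∷ S) m a
Frontier-take {S = S} {a} {m} B⊆S ≥m-off-B p = record
  { B⊆S       = there ∘ B⊆S
  ; ≥p-off-B  = λ { (here refl) _ → ≤-refl ; (there y∈S) y∉B → ≥m-off-B y∈S y∉B }
  ; [p,top]⊆S = [m,a]⊆
  }
  where
  [m,a]⊆ : ∀ {y} → m ≤ y → y ≤ a → y ∈ m ∷ S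
  [m,a]⊆ {y} m≤y y≤a with y ≟ m
  ... | yes y≡m = here y≡m
  ... | no y≢m = there (gap⊆ p (≤∧≢⇒< m≤y (y≢m ∘ sym)) y≤a)

maxBelow-cap< : ∀ a p B → maxBelow (a ⊓ (p - 1ℤ)) B < p
maxBelow-cap< a p B =
  ≤-<-trans (≤-trans (≤bound (maxBelow-isMaxBelow _ B)) (i⊓j≤j a _)) (i-1<i p)

Frontier-capped : ∀ {B S p top a} → Frontier B S p top → a < top →
                  IsMaxBelow a S (maxBelow (a ⊓ (p - 1ℤ)) B)
Frontier-capped {B} {S} {p} {a = a} F a<top = record
  { ≤bound = ≤-trans (≤bound spec) (i⊓j≤i a _)
  ; ∉set   = λ m∈S → <-irrefl refl (<-≤-trans (maxBelow-cap< a p B) (≥p-off-B F m∈S (∉set spec)))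
  ; gap⊆   = gap
  }
  where
  spec = maxBelow-isMaxBelow (a ⊓ (p - 1ℤ)) B
  gap : ∀ {y} → maxBelow (a ⊓ (p - 1ℤ)) B < y → y ≤ a → y ∈ S
  gap {y} m<y y≤a with y ≤? p - 1ℤ
  ... | yes y≤p-1 = B⊆S F (gap⊆ spec m<y (⊓-glb y≤a y≤p-1))
  ... | no y≰p-1 = [p,top]⊆S F (i≰j-1⇒j≤i y≰p-1) (<⇒≤ (≤-<-trans y≤a a<top))

maxcolDesc-just≡greedy : ∀ {B S p top D} → Frontier B S p top → Linked _>_ (top ∷ D) →
                         maxcolDesc B (just p) D ≡ greedy S D
maxcolDesc-just≡greedy {D = []} _ _ = refl
maxcolDesc-just≡greedy {B} {S} {p} {D = a ∷ D} F (a<top ∷ linked)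
  rewrite maxBelow-unique (Frontier-capped F a<top) =
  cong (_ ∷_) (maxcolDesc-just≡greedy (Frontier-take (B⊆S F) ≥m-off-B (Frontier-capped F a<top)) linked)
  where
  ≥m-off-B : ∀ {y} → y ∈ S → y ∉ B → maxBelow (a ⊓ (p - 1ℤ)) B ≤ y
  ≥m-off-B y∈S y∉B = <⇒≤ (<-≤-trans (maxBelow-cap< a p B) (≥p-off-B F y∈S y∉B))

maxcolDesc≡greedy : ∀ {B D} → Linked _>_ D → maxcolDesc B nothing D ≡ greedy B D
maxcolDesc≡greedy {D = []} _ = refl
maxcolDesc≡greedy {B} {a ∷ D} linked = cong (maxBelow a B ∷_) (maxcolDesc-just≡greedy first linked)
  where
  first : Frontier B (maxBelow a B ∷ B) (maxBelow a B) a
  first = Frontier-take (λ y∈B → y∈B) (λ y∈B y∉B → ⊥-elim (y∉B y∈B)) (maxBelow-isMaxBelow a B)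

maxcol≡reverse-greedy : ∀ {A} B → Linked _<_ A → maxcol A B ≡ reverse (greedy B (reverse A))
maxcol≡reverse-greedy B increasing =
  cong reverse (maxcolDesc≡greedy (AllPairs⇒Linked (AllPairs-reverse (Linked⇒AllPairs <-trans increasing))))

maxcol↭greedy : ∀ {A} B → Linked _<_ A → maxcol A B ↭ greedy B A
maxcol↭greedy {A} B increasing = ↭-trans (↭-reflexive (maxcol≡reverse-greedy B increasing))
  (↭-trans (↭-reverse _) (greedy-↭ (↭-reverse A) B))

col-cast : ∀ A B k → col A B (cast (maxcol-length A B) k) ≡ lookup (maxcol A B) k
col-cast A B k = cong (lookup (maxcol A B)) (cast-involutive (sym (maxcol-length A B)) (maxcol-length A B) k)

maxcol-split : ∀ {A} B pre a post → Linked _<_ A → A ≡ pre ++ a ∷ post →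
  let X = greedy B (reverse post) ; c = maxBelow a (X ++ B) in
  maxcol A B ≡ reverse (greedy (c ∷ X ++ B) (reverse pre)) ++ c ∷ reverse X
maxcol-split {A} B pre a post increasing A≡ = begin
  maxcol A B                                              ≡⟨ maxcol≡reverse-greedy B increasing ⟩
  reverse (greedy B (reverse A))                          ≡⟨ cong (reverse ∘ greedy B) reverse-A ⟩
  reverse (greedy B (reverse post ++ a ∷ reverse pre))    ≡⟨ cong reverse (greedy-++ B (reverse post) _) ⟩
  reverse (X ++ c ∷ greedy (c ∷ X ++ B) (reverse pre))    ≡⟨ reverse-++-∷ X c _ ⟩
  reverse (greedy (c ∷ X ++ B) (reverse pre)) ++ c ∷ reverse X ∎
  where
  open ≡-Reasoning
  X = greedy B (reverse post)
  c = maxBelow a (X ++ B)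
  reverse-A : reverse A ≡ reverse post ++ a ∷ reverse pre
  reverse-A = trans (cong reverse A≡) (reverse-++-∷ pre a post)

maxcol-interval : ∀ {A} B → Linked _<_ A → ∀ i x → col A B i ≤ x → x ≤ lookup A i →
                  x ∈ B ⊎ ∃ λ (j : Fin (length A)) → i ≤ᶠ j × x ≡ col A B j
maxcol-interval {A} B increasing i x col≤x x≤a with lookup-split A i
... | pre , post , A≡ , length-pre = cases
  where
  a = lookup A i
  X = greedy B (reverse post)
  c = maxBelow a (X ++ B)
  P = reverse (greedy (c ∷ X ++ B) (reverse pre))
  length-P : length P ≡ toℕ i
  length-P = begin
    length P                                     ≡⟨ length-reverse (greedy (c ∷ X ++ B) (reverse pre)) ⟩
    length (greedy (c ∷ X ++ B) (reverse pre))   ≡⟨ length-greedy (c ∷ X ++ B) (reverse pre) ⟩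
    length (reverse pre)                         ≡⟨ length-reverse pre ⟩
    length pre                                   ≡⟨ length-pre ⟩
    toℕ i                                        ∎
    where open ≡-Reasoning
  split = maxcol-split B pre a post increasing A≡
  ml = maxcol-length A B
  col≡c : col A B i ≡ c
  col≡c = lookup-at-length P c (reverse X) split (cast (sym ml) i) (trans (toℕ-cast (sym ml) i) (sym length-P))
  c<x : x ≢ c → c < x
  c<x x≢c = ≤∧≢⇒< (subst (_≤ x) col≡c col≤x) (x≢c ∘ sym)
  later : ∀ {y} → y ∈ c ∷ reverse X → ∃ λ (j : Fin (length A)) → i ≤ᶠ j × y ≡ col A B j
  later y∈ with ∈-suffix⇒lookup P (c ∷ reverse X) split y∈
  ... | k , P≤k , lookup≡ =
    cast ml k , ℕ.≤-trans (ℕ.≤-reflexive (sym length-P)) (ℕ.≤-trans P≤k (ℕ.≤-reflexive (sym (toℕ-cast ml k)))) ,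
    trans (sym lookup≡) (sym (col-cast A B k))
  cases : x ∈ B ⊎ ∃ λ (j : Fin (length A)) → i ≤ᶠ j × x ≡ col A B j
  cases with x ≟ c
  ... | yes x≡c = inj₂ (later (here x≡c))
  ... | no x≢c with ∈-++⁻ X (gap⊆ (maxBelow-isMaxBelow a (X ++ B)) (c<x x≢c) x≤a)
  ...   | inj₁ x∈X = inj₂ (later (there (reverse⁺ x∈X)))
  ...   | inj₂ x∈B = inj₁ x∈B

_∖_ : List ℤ → List ℤ → List ℤ
A ∖ B = filter (∁? (_∈? B)) A

∈-∖⁻ : ∀ A {B x} → x ∈ A ∖ B → x ∈ A × x ∉ B
∈-∖⁻ A = ∈-filter⁻ (∁? (_∈? _)) {xs = A}

∈-∖⁺ : ∀ {A B x} → x ∈ A × x ∉ B → x ∈ A ∖ B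
∈-∖⁺ (x∈A , x∉B) = ∈-filter⁺ (∁? (_∈? _)) x∈A x∉B

↭-∩ˡ-++-∖ : ∀ A B → A ↭ (A ∩ˡ B) ++ (A ∖ B)
↭-∩ˡ-++-∖ A B = subst (λ parts → A ↭ proj₁ parts ++ proj₂ parts) (partition-defn (_∈? B) A)
  (↭ₛ⇒↭ (PermutationSetoid.partition-↭ (setoid ℤ) (_∈? B) A))

∪ˡ-⊆-∖-++ : ∀ A B → A ∪ˡ B ⊆ (A ∖ B) ++ B
∪ˡ-⊆-∖-++ A B {x} x∈A∪B with ∈-++⁻ A x∈A∪B | x ∈? B
... | inj₂ x∈B | _       = ∈-++⁺ʳ _ x∈B
... | inj₁ _   | yes x∈B = ∈-++⁺ʳ _ x∈B
... | inj₁ x∈A | no x∉B  = ∈-++⁺ˡ (∈-∖⁺ (x∈A , x∉B))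

∩ˡ-increasing : ∀ {A} B → Linked _<_ A → Linked _<_ (A ∩ˡ B)
∩ˡ-increasing B = LinkedP.filter⁺ (_∈? B) <-trans

maxcol-decompose : ∀ {A} B → Linked _<_ A → maxcol A B ↭ (A ∖ B) ++ maxcol (A ∩ˡ B) (A ∪ˡ B)
maxcol-decompose {A} B increasing = begin
  maxcol A B                                ↭⟨ maxcol↭greedy B increasing ⟩
  greedy B A                                ↭⟨ greedy-↭ (↭-trans (↭-∩ˡ-++-∖ A B) (++-comm W U)) B ⟩
  greedy B (U ++ W)                         ≡⟨ greedy-++ B U W ⟩
  greedy B U ++ greedy (greedy B U ++ B) W  ≡⟨ cong (λ V → V ++ greedy (V ++ B) W) (greedy-fresh B U U∉B unique-U) ⟩
  U ++ greedy (U ++ B) W                    ≡⟨ cong (U ++_) (greedy-cong W (++⁺-⊆ (filter-⊆ _ A) (λ y∈B → y∈B))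
                                                                       (∪ˡ-⊆-∖-++ A B)) ⟩
  U ++ greedy (A ∪ˡ B) W                    ↭⟨ ++⁺ˡ U (maxcol↭greedy (A ∪ˡ B) (∩ˡ-increasing B increasing)) ⟨
  U ++ maxcol W (A ∪ˡ B)                    ∎
  where
  open PermutationReasoning
  U = A ∖ B
  W = A ∩ˡ B
  U∉B : All (_∉ B) U
  U∉B = All.tabulate (proj₂ ∘ ∈-∖⁻ A)
  unique-U : Unique U
  unique-U = UniqueP.filter⁺ _ (AllPairs.map (<⇒≢) (Linked⇒AllPairs <-trans increasing))

∈-maxcol⇔ : ∀ {A} B → Linked _<_ A → ∀ {x} →
            x ∈ maxcol A B ⇔ ((x ∈ A × x ∉ B) ⊎ x ∈ maxcol (A ∩ˡ B) (A ∪ˡ B))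
∈-maxcol⇔ {A} B increasing = mk⇔ to from
  where
  decompose = maxcol-decompose B increasing
  to : ∀ {x} → x ∈ maxcol A B → (x ∈ A × x ∉ B) ⊎ x ∈ maxcol (A ∩ˡ B) (A ∪ˡ B)
  to x∈ with ∈-++⁻ (A ∖ B) (∈-resp-↭ decompose x∈)
  ... | inj₁ x∈A∖B = inj₁ (∈-∖⁻ A x∈A∖B)
  ... | inj₂ x∈R = inj₂ x∈R
  from : ∀ {x} → (x ∈ A × x ∉ B) ⊎ x ∈ maxcol (A ∩ˡ B) (A ∪ˡ B) → x ∈ maxcol A B
  from (inj₁ x∈A∖B) = ∈-resp-↭ (↭-sym decompose) (∈-++⁺ˡ (∈-∖⁺ x∈A∖B))
  from (inj₂ x∈R) = ∈-resp-↭ (↭-sym decompose) (∈-++⁺ʳ (A ∖ B) x∈R)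

∈-maxcol⇒∉ : ∀ {A} B → Linked _<_ A → ∀ {x} → x ∈ maxcol A B → x ∉ B
∈-maxcol⇒∉ {A} B increasing x∈ = ∈-greedy⇒∉ A B (∈-resp-↭ (maxcol↭greedy B increasing) x∈)

lemma8p6 : (A B : List ℤ) → Linked _<_ A →
    (∀ (i : Fin (length A)) (x : ℤ) → col A B i ≤ x → x ≤ lookup A i →
        x ∈ B ⊎ ∃ (λ (j : Fin (length A)) → i ≤ᶠ j × x ≡ col A B j))
    × (∀ x → x ∈ A → x ∉ B → x ∈ maxcol A B)
    × (∀ x → (x ∈ maxcol A B) ⇔ ((x ∈ A × x ∉ B) ⊎ x ∈ maxcol (A ∩ˡ B) (A ∪ˡ B)))
    × (∀ x → x ∈ A → x ∉ B → x ∉ maxcol (A ∩ˡ B) (A ∪ˡ B))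
lemma8p6 A B increasing =
    maxcol-interval B increasing
  , (λ _ x∈A x∉B → Equivalence.from (∈-maxcol⇔ B increasing) (inj₁ (x∈A , x∉B)))
  , (λ _ → ∈-maxcol⇔ B increasing)
  , (λ _ x∈A _ x∈R → ∈-maxcol⇒∉ (A ∪ˡ B) (∩ˡ-increasing B increasing) x∈R (∈-++⁺ˡ x∈A))
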